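{- Let $k$ be a positive integer and, for $n\ge 0$, let $$\omega_n^{(k)}=\sum_{m=0}^n\left[{n\atop m}\right]\frac{1}{(m+1)^k}.$$ For each $n\ge 3$ let $K_n$ be the index $m$ at which the unsigned Stirling number of the first kind $\left[{n\atop m}\right]$ ($0\le m\le n$) is maximal. Then for every $n\ge 3$, $$\omega_n^{(k)}<\left[{n\atop K_n}\right]\sum_{m=1}^n\frac{1}{(m+1)^k}.$$
   Context: The unsigned Stirling numbers of the first kind $\left[{n\atop m}\right]$ are defined by $x(x+1)\cdots(x+n-1)=\sum_{m=0}^n\left[{n\atop m}\right]x^m$. The number $\omega_n^{(k)}$ equals $(-1)^n\widehat c_n^{(k)}=\int_{[0,1]^k}\langle x_1\cdots x_k\rangle_n\,dx_1\cdots dx_k$, where $\widehat c_n^{(k)}$ is the poly-Cauchy number of the second kind and $\langle x\rangle_n=x(x+1)\cdots(x+n-1)$. -}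

module Defs where

open import Data.Nat using (ℕ; zero; suc; _+_; _*_; _^_)
open import Data.Rational using (ℚ; _/_)
open import Data.Integer using (+_)
open import Data.Nat.Properties using (m^n≢0)
import Data.Rational as ℚ

-- Unsigned Stirling numbers of the first kind [n m]:
-- [0 0] = 1, [0 (m+1)] = 0, [(n+1) 0] = 0,
-- [(n+1) (m+1)] = n * [n (m+1)] + [n m]
-- (the standard recurrence coming from x(x+1)...(x+n-1) = Σ [n m] x^m).
stirling1 : ℕ → ℕ → ℕ
stirling1 zero    zero    = 1
stirling1 zero    (suc m) = 0
stirling1 (suc n) zero    = 0
stirling1 (suc n) (suc m) = n * stirling1 n (suc m) + stirling1 n m

sumTo : ℕ → (ℕ → ℚ) → ℚ
sumTo zero    f = f 0
sumTo (suc n) f = sumTo n f ℚ.+ f (suc n)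

sumFrom1 : ℕ → (ℕ → ℚ) → ℚ
sumFrom1 zero    f = ℚ.0ℚ
sumFrom1 (suc n) f = sumFrom1 n f ℚ.+ f (suc n)

invPow : ℕ → ℕ → ℚ
invPow k m = _/_ (+ 1) ((suc m) ^ k) {{m^n≢0 (suc m) k}}

natℚ : ℕ → ℚ
natℚ a = + a / 1

omega : ℕ → ℕ → ℚ
omega k n = sumTo n (λ m → natℚ (stirling1 n m) ℚ.* invPow k m)

{-# OPTIONS --safe #-}
module Submission where

open import Defs
open import Data.Nat using (ℕ; zero; suc; _≤_; _<_; _!; z≤n; s≤s)
open import Data.Rational using (_*_)
import Data.Rational as ℚ

import Data.Nat as ℕ
import Data.Nat.Properties as ℕ
import Data.Rational.Properties as ℚ
import Data.Integer as ℤ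
import Data.Integer.Properties as ℤ
open import Data.Nat.Coprimality using (1-coprimeTo) renaming (sym to coprime-sym)
open import Relation.Binary.PropositionalEquality

-- Since [n 0] = 0 for n ≥ 1, ω is a sum over 1 ≤ m ≤ n. Each of its terms is at most
-- [n K]/(m+1)^k by maximality of K, and the last one is strictly smaller because
-- [n n] = 1 < (n-1)! = [n 1] ≤ [n K] once n ≥ 3.

natℚ≡mkℚ : ∀ a → natℚ a ≡ ℚ.mkℚ (ℤ.+ a) 0 (coprime-sym (1-coprimeTo a))
natℚ≡mkℚ a = ℚ.normalize-coprime (coprime-sym (1-coprimeTo a))

natℚ-mono-≤ : ∀ {a b} → a ≤ b → natℚ a ℚ.≤ natℚ b
natℚ-mono-≤ {a} {b} a≤b rewrite natℚ≡mkℚ a | natℚ≡mkℚ b =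
  ℚ.*≤* (subst₂ ℤ._≤_ (sym (ℤ.*-identityʳ (ℤ.+ a))) (sym (ℤ.*-identityʳ (ℤ.+ b))) (ℤ.+≤+ a≤b))

natℚ-mono-< : ∀ {a b} → a < b → natℚ a ℚ.< natℚ b
natℚ-mono-< {a} {b} a<b rewrite natℚ≡mkℚ a | natℚ≡mkℚ b =
  ℚ.*<* (subst₂ ℤ._<_ (sym (ℤ.*-identityʳ (ℤ.+ a))) (sym (ℤ.*-identityʳ (ℤ.+ b))) (ℤ.+<+ a<b))

invPow-pos : ∀ k m → ℚ.Positive (invPow k m)
invPow-pos k m = ℚ.normalize-pos 1 (suc m ℕ.^ k) {{ℕ.m^n≢0 (suc m) k}}

sumTo≡head+sumFrom1 : ∀ n f → sumTo n f ≡ f 0 ℚ.+ sumFrom1 n f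
sumTo≡head+sumFrom1 zero    f = sym (ℚ.+-identityʳ (f 0))
sumTo≡head+sumFrom1 (suc n) f = begin
  sumTo n f ℚ.+ f (suc n)                   ≡⟨ cong (ℚ._+ f (suc n)) (sumTo≡head+sumFrom1 n f) ⟩
  (f 0 ℚ.+ sumFrom1 n f) ℚ.+ f (suc n)      ≡⟨ ℚ.+-assoc (f 0) (sumFrom1 n f) (f (suc n)) ⟩
  f 0 ℚ.+ (sumFrom1 n f ℚ.+ f (suc n))      ∎
  where open ≡-Reasoning

*-distribˡ-sumFrom1 : ∀ c n f → c * sumFrom1 n f ≡ sumFrom1 n (λ m → c * f m)
*-distribˡ-sumFrom1 c zero    f = ℚ.*-zeroʳ c
*-distribˡ-sumFrom1 c (suc n) f = begin
  c * (sumFrom1 n f ℚ.+ f (suc n))                    ≡⟨ ℚ.*-distribˡ-+ c (sumFrom1 n f) (f (suc n)) ⟩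
  c * sumFrom1 n f ℚ.+ c * f (suc n)                  ≡⟨ cong (ℚ._+ c * f (suc n)) (*-distribˡ-sumFrom1 c n f) ⟩
  sumFrom1 n (λ m → c * f m) ℚ.+ c * f (suc n)        ∎
  where open ≡-Reasoning

sumFrom1-mono-≤ : ∀ n {f g} → (∀ m → 1 ≤ m → m ≤ n → f m ℚ.≤ g m) →
                  sumFrom1 n f ℚ.≤ sumFrom1 n g
sumFrom1-mono-≤ zero    f≤g = ℚ.≤-refl
sumFrom1-mono-≤ (suc n) f≤g = ℚ.+-mono-≤
  (sumFrom1-mono-≤ n (λ m 1≤m m≤n → f≤g m 1≤m (ℕ.m≤n⇒m≤1+n m≤n)))
  (f≤g (suc n) (s≤s z≤n) ℕ.≤-refl)

sumFrom1-mono-<-last : ∀ n {f g} → (∀ m → 1 ≤ m → m ≤ n → f m ℚ.≤ g m) →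
                       f (suc n) ℚ.< g (suc n) → sumFrom1 (suc n) f ℚ.< sumFrom1 (suc n) g
sumFrom1-mono-<-last n f≤g f<g = ℚ.+-mono-≤-< (sumFrom1-mono-≤ n f≤g) f<g

stirling1-above : ∀ n m → n < m → stirling1 n m ≡ 0
stirling1-above zero    (suc m) _         = refl
stirling1-above (suc n) (suc m) (s≤s n<m)
  rewrite stirling1-above n (suc m) (ℕ.m≤n⇒m≤1+n n<m) | stirling1-above n m n<m | ℕ.*-zeroʳ n = refl

stirling1-diag : ∀ n → stirling1 n n ≡ 1
stirling1-diag zero    = refl
stirling1-diag (suc n)
  rewrite stirling1-above n (suc n) ℕ.≤-refl | stirling1-diag n | ℕ.*-zeroʳ n = refl

stirling1-suc-1 : ∀ n → stirling1 (suc n) 1 ≡ n !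
stirling1-suc-1 zero    = refl
stirling1-suc-1 (suc n) rewrite stirling1-suc-1 n = ℕ.+-identityʳ (suc n ℕ.* n !)

1<[2+n]! : ∀ n → 1 < suc (suc n) !
1<[2+n]! n = ℕ.*-mono-≤ {2} {suc (suc n)} {1} (s≤s (s≤s z≤n)) (ℕ.1≤n! (suc n))

omega≡sumFrom1 : ∀ k n →
  omega k (suc n) ≡ sumFrom1 (suc n) (λ m → natℚ (stirling1 (suc n) m) * invPow k m)
omega≡sumFrom1 k n = begin
  omega k (suc n)                  ≡⟨ sumTo≡head+sumFrom1 (suc n) term ⟩
  term 0 ℚ.+ sumFrom1 (suc n) term ≡⟨ cong (ℚ._+ sumFrom1 (suc n) term) (ℚ.*-zeroˡ (invPow k 0)) ⟩
  ℚ.0ℚ ℚ.+ sumFrom1 (suc n) term   ≡⟨ ℚ.+-identityˡ _ ⟩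
  sumFrom1 (suc n) term            ∎
  where
  open ≡-Reasoning
  term : ℕ → ℚ.ℚ
  term m = natℚ (stirling1 (suc n) m) * invPow k m

theorem2p2 : (k : ℕ) → 1 ≤ k → (n : ℕ) → 3 ≤ n →
    (K : ℕ) → K ≤ n → (∀ m → m ≤ n → stirling1 n m ≤ stirling1 n K) →
    omega k n ℚ.< natℚ (stirling1 n K) * sumFrom1 n (invPow k)
theorem2p2 k _ n@(suc n-1@(suc (suc j))) (s≤s (s≤s (s≤s _))) K _ K-max =
  subst₂ ℚ._<_ (sym (omega≡sumFrom1 k n-1)) (sym (*-distribˡ-sumFrom1 S n (invPow k)))
    (sumFrom1-mono-<-last n-1 (λ m _ m≤n-1 → term≤ m (ℕ.m≤n⇒m≤1+n m≤n-1)) last-term<)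
  where
  S : ℚ.ℚ
  S = natℚ (stirling1 n K)

  term≤ : ∀ m → m ≤ n → natℚ (stirling1 n m) * invPow k m ℚ.≤ S * invPow k m
  term≤ m m≤n = ℚ.*-monoʳ-≤-nonNeg (invPow k m) {{ℚ.pos⇒nonNeg (invPow k m) {{invPow-pos k m}}}}
    (natℚ-mono-≤ (K-max m m≤n))

  diag<max : stirling1 n n < stirling1 n K
  diag<max = begin-strict
    stirling1 n n  ≡⟨ stirling1-diag n ⟩
    1              <⟨ 1<[2+n]! j ⟩
    n-1 !          ≡⟨ stirling1-suc-1 n-1 ⟨
    stirling1 n 1  ≤⟨ K-max 1 (s≤s z≤n) ⟩
    stirling1 n K  ∎
    where open ℕ.≤-Reasoning

  last-term< : natℚ (stirling1 n n) * invPow k n ℚ.< S * invPow k n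
  last-term< = ℚ.*-monoˡ-<-pos (invPow k n) {{invPow-pos k n}} (natℚ-mono-< diag<max)
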